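{- Let $q$ be a power of an odd prime and let $G$ be a connected labeled graph over $\mathbf{F}_q$ on $\{1,\dots,n\}$ with $n\ge3$. Suppose $\dim\Lambda_0(G,G)\ge5$. Then $\Psi(\phi,\phi')=0$ for all $\phi,\phi'\in\Lambda_0^0(G,G)$; equivalently, $\Lambda_0^0(G,G)$ is a linear subspace of $\mathbf{F}_q^{4n}$.
   Context: A labeled graph is a symmetric matrix $G=(g_{ij})$ over $\mathbf{F}_q$ with zero diagonal; $ij$ is an edge iff $g_{ij}\ne0$ and connectivity refers to this simple graph. Neighborhood function $g(i)=(g_{i1},\dots,g_{in})$; $e_i$ standard basis vectors; $I$ all-ones vector; $\times$ coordinatewise product; $\langle u,v\rangle=\sum_ku_kv_k$. $\Lambda(G,G)$ is the set of $(X,Y,Z,T)\in(\mathbf{F}_q^n)^4$ with $\langle X,g(i)\times g(j)\rangle-\langle Y,g(i)\times e_j\rangle+\langle Z,e_i\times g(j)\rangle-\langle T,e_i\times e_j\rangle=0$ for all $i,j$. $\Lambda_0(G,G)=\{(X,Y,Z,T)\in\Lambda(G,G):Y+Z=0\}$ (a linear subspace); $\det(X,Y,Z,T)=Y\times Z-X\times T$; $\Lambda_0^0(G,G)=\{\phi\in\Lambda_0(G,G):\det\phi=0\}$. For $\phi=(X,Y,-Y,T),\phi'=(X',Y',-Y',T')\in\Lambda_0(G,G)$, $\Psi(\phi,\phi')=2Y\times Y'+X\times T'+X'\times T$. -}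

module Defs where

open import Level using (Level; _⊔_)
open import Algebra.Bundles using (CommutativeRing)
open import Data.Nat using (ℕ; zero; suc)
open import Data.Fin using (Fin; zero; suc; _≟_)
open import Data.Product using (Σ; ∃; _×_; _,_)
open import Relation.Nullary using (¬_; yes; no)
open import Relation.Binary.PropositionalEquality using (_≡_)

module Over {c ℓ : Level} (R : CommutativeRing c ℓ) where
  open CommutativeRing R using (_≈_; _+_; _*_; _-_; 0#; 1#) renaming (Carrier to F)

  IsField : Set (c ⊔ ℓ)
  IsField = (¬ (1# ≈ 0#)) × (∀ x → ¬ (x ≈ 0#) → ∃ λ y → x * y ≈ 1#)

  HasCard : ℕ → Set (c ⊔ ℓ)
  HasCard q = Σ (Fin q → F) λ e →
    (∀ i j → e i ≈ e j → i ≡ j) × (∀ x → ∃ λ i → e i ≈ x)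

  Vec : ℕ → Set c
  Vec n = Fin n → F

  sum : ∀ {n} → Vec n → F
  sum {zero}  v = 0#
  sum {suc n} v = v zero + sum (λ k → v (suc k))

  _×ᵥ_ : ∀ {n} → Vec n → Vec n → Vec n
  (u ×ᵥ v) k = u k * v k

  ⟨_,_⟩ : ∀ {n} → Vec n → Vec n → F
  ⟨ u , v ⟩ = sum (u ×ᵥ v)

  e : ∀ {n} → Fin n → Vec n
  e i k with i ≟ k
  ... | yes _ = 1#
  ... | no  _ = 0#

  IsLabeledGraph : ∀ {n} → (Fin n → Fin n → F) → Set ℓ
  IsLabeledGraph {n} g = (∀ i j → g i j ≈ g j i) × (∀ i → g i i ≈ 0#)

  data Walk {n} (g : Fin n → Fin n → F) : Fin n → Fin n → Set (c ⊔ ℓ) where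
    here : ∀ {i} → Walk g i i
    step : ∀ {i k j} → ¬ (g i k ≈ 0#) → Walk g k j → Walk g i j

  Connected : ∀ {n} → (Fin n → Fin n → F) → Set (c ⊔ ℓ)
  Connected g = ∀ i j → Walk g i j

  record Quad (n : ℕ) : Set c where
    constructor quad
    field
      X Y Z T : Vec n
  open Quad public

  InΛ : ∀ {n} → (Fin n → Fin n → F) → Quad n → Set ℓ
  InΛ g φ = ∀ i j →
    ((⟨ X φ , g i ×ᵥ g j ⟩ - ⟨ Y φ , g i ×ᵥ e j ⟩) + ⟨ Z φ , e i ×ᵥ g j ⟩)
      - ⟨ T φ , e i ×ᵥ e j ⟩ ≈ 0#

  InΛ₀ : ∀ {n} → (Fin n → Fin n → F) → Quad n → Set ℓ
  InΛ₀ g φ = InΛ g φ × (∀ k → Y φ k + Z φ k ≈ 0#)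

  det : ∀ {n} → Quad n → Vec n
  det φ k = Y φ k * Z φ k - X φ k * T φ k

  InΛ₀⁰ : ∀ {n} → (Fin n → Fin n → F) → Quad n → Set ℓ
  InΛ₀⁰ g φ = InΛ₀ g φ × (∀ k → det φ k ≈ 0#)

  Ψ : ∀ {n} → Quad n → Quad n → Vec n
  Ψ φ φ' k = ((1# + 1#) * (Y φ k * Y φ' k) + X φ k * T φ' k) + X φ' k * T φ k

  IsZeroQuad : ∀ {n} → Quad n → Set ℓ
  IsZeroQuad φ = ∀ k → (X φ k ≈ 0#) × (Y φ k ≈ 0#) × (Z φ k ≈ 0#) × (T φ k ≈ 0#)

  lincomb : ∀ {m n} → Vec m → (Fin m → Quad n) → Quad n
  lincomb a φs = quad (λ k → sum (λ r → a r * X (φs r) k))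
                      (λ k → sum (λ r → a r * Y (φs r) k))
                      (λ k → sum (λ r → a r * Z (φs r) k))
                      (λ k → sum (λ r → a r * T (φs r) k))

  LinIndep : ∀ {m n} → (Fin m → Quad n) → Set (c ⊔ ℓ)
  LinIndep φs = ∀ a → IsZeroQuad (lincomb a φs) → ∀ r → a r ≈ 0#

  DimΛ₀≥ : ∀ {n} → ℕ → (Fin n → Fin n → F) → Set (c ⊔ ℓ)
  DimΛ₀≥ {n} m g = Σ (Fin m → Quad n) λ φs → (∀ r → InΛ₀ g (φs r)) × LinIndep φs

-- At a vertex k, a point (X, Y, Z, T) of F^{4n} is the 2 × 2 matrix [[Y, X], [T, Z]].
-- The equations of Λ(G,G) make these matrices, acting vertexwise on F^n × F^n, map
-- the graph {(u, -Gu)} of -G into itself; so Λ(G,G) is closed under vertexwise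
-- products, and on a connected graph its scalar elements are constant. For traceless
-- a, b, x (elements of Λ₀) the matrices ab + ba and xab - bax are the scalars ψ(a,b)
-- and tr(xab), which are therefore constant along the graph. The trace form expands
-- every traceless x in the frame a, b, [a,b]:
--   (ψ(a,b)² - ψ(a,a)ψ(b,b)) x
--     = tr(xab) [a,b] + ψ(x,b) (ψ(a,b) a - ψ(a,a) b) + ψ(x,a) (ψ(a,b) b - ψ(b,b) a).
-- If this Gram determinant were nonzero, x ↦ (tr(xab), ψ(x,b), ψ(x,a)) would embed Λ₀
-- into F³; with four independent elements it therefore vanishes. For φ, φ' ∈ Λ₀⁰,
-- nilpotency gives ψ(φ,φ) = ψ(φ',φ') = 0, hence Ψ(φ,φ')² = 0.

{-# OPTIONS --safe #-}
module Submission where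

open import Defs
open import Level using (Level; _⊔_; 0ℓ)
open import Algebra.Bundles using (CommutativeRing)
open import Algebra.Bundles.Raw using (RawRing)
open import Algebra.Core using (Op₂)
open import Algebra.Solver.Ring.AlmostCommutativeRing
  using (_-Raw-AlmostCommutative⟶_; fromCommutativeRing)
open import Data.Fin.Base using (Fin; zero; suc; punchIn)
open import Data.Fin.Properties using (_≟_; all?; ¬∀⟶∃¬; punchInᵢ≢i)
open import Data.Integer.Base as ℤ using (ℤ; +_; -[1+_]; sign; ∣_∣; _◃_)
import Data.Integer.Properties as ℤ
open import Data.Maybe.Base using (Maybe; just; nothing)
open import Data.Nat.Base as ℕ using (ℕ; zero; suc)
import Data.Nat.Properties as ℕ
open import Data.Product.Base using (∃; _×_; _,_; proj₁; proj₂)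
open import Data.Sign.Base as Sign using (Sign)
open import Data.Vec.Functional using (insertAt; _∷_; [])
open import Data.Vec.Functional.Properties using (insertAt-lookup; removeAt-insertAt)
open import Data.Vec.N-ary using (N-ary; N-ary-level)
open import Function.Base using (_∘_)
open import Relation.Nullary using (¬_; Dec; yes; no; contradiction)
open import Relation.Binary.PropositionalEquality.Core as ≡ using (_≡_)

module IntegerCoefficientSolver {c ℓ} (R : CommutativeRing c ℓ) where
  open CommutativeRing R
  open import Algebra.Properties.Ring ring using (-‿involutive; -‿+-comm; -0#≈0#; -1*x≈-x)
  open import Algebra.Properties.Semiring.Mult.TCOptimised semiring using (1+×; ×-homo-+; ×1-homo-*)
    renaming (_×_ to _×ₙ_)
  open import Algebra.Properties.CommutativeSemigroup *-commutativeSemigroup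
    using () renaming (interchange to *-interchange)
  open import Relation.Binary.Reasoning.Setoid setoid

  -- the TC-optimised multiple makes ⟦ + 0 ⟧ᶻ and ⟦ + 1 ⟧ᶻ reduce to 0# and 1#, so a
  -- matrix expression built from solver polynomials evaluates to the same expression over R
  ⟦_⟧ᶻ : ℤ → Carrier
  ⟦ + n ⟧ᶻ      = n ×ₙ 1#
  ⟦ -[1+ n ] ⟧ᶻ = - (suc n ×ₙ 1#)

  private
    [1+m]-[1+n]≈m-n : ∀ m n → suc m ×ₙ 1# - suc n ×ₙ 1# ≈ m ×ₙ 1# - n ×ₙ 1#
    [1+m]-[1+n]≈m-n m n = begin
      suc m ×ₙ 1# - suc n ×ₙ 1#               ≈⟨ +-cong (1+× m 1#) (-‿cong (1+× n 1#)) ⟩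
      (1# + m ×ₙ 1#) - (1# + n ×ₙ 1#)         ≈⟨ +-congˡ (-‿+-comm 1# (n ×ₙ 1#)) ⟨
      (1# + m ×ₙ 1#) + (- 1# - n ×ₙ 1#)       ≈⟨ +-assoc 1# (m ×ₙ 1#) _ ⟩
      1# + (m ×ₙ 1# + (- 1# - n ×ₙ 1#))       ≈⟨ +-congˡ (+-assoc (m ×ₙ 1#) (- 1#) _) ⟨
      1# + ((m ×ₙ 1# - 1#) - n ×ₙ 1#)         ≈⟨ +-congˡ (+-congʳ (+-comm (m ×ₙ 1#) (- 1#))) ⟩
      1# + ((- 1# + m ×ₙ 1#) - n ×ₙ 1#)       ≈⟨ +-congˡ (+-assoc (- 1#) _ _) ⟩
      1# + (- 1# + (m ×ₙ 1# - n ×ₙ 1#))       ≈⟨ +-assoc 1# (- 1#) _ ⟨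
      (1# - 1#) + (m ×ₙ 1# - n ×ₙ 1#)         ≈⟨ +-congʳ (-‿inverseʳ 1#) ⟩
      0# + (m ×ₙ 1# - n ×ₙ 1#)                ≈⟨ +-identityˡ _ ⟩
      m ×ₙ 1# - n ×ₙ 1#                       ∎

    ⊖-homo : ∀ m n → ⟦ m ℤ.⊖ n ⟧ᶻ ≈ m ×ₙ 1# - n ×ₙ 1#
    ⊖-homo zero    zero    = sym (-‿inverseʳ 0#)
    ⊖-homo zero    (suc n) = sym (+-identityˡ _)
    ⊖-homo (suc m) zero    = sym (trans (+-congˡ -0#≈0#) (+-identityʳ _))
    ⊖-homo (suc m) (suc n) = begin
      ⟦ suc m ℤ.⊖ suc n ⟧ᶻ     ≡⟨ ≡.cong ⟦_⟧ᶻ (ℤ.[1+m]⊖[1+n]≡m⊖n m n) ⟩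
      ⟦ m ℤ.⊖ n ⟧ᶻ             ≈⟨ ⊖-homo m n ⟩
      m ×ₙ 1# - n ×ₙ 1#          ≈⟨ [1+m]-[1+n]≈m-n m n ⟨
      suc m ×ₙ 1# - suc n ×ₙ 1#  ∎

    +-homo : ∀ i j → ⟦ i ℤ.+ j ⟧ᶻ ≈ ⟦ i ⟧ᶻ + ⟦ j ⟧ᶻ
    +-homo (+ m)    (+ n)    = ×-homo-+ 1# m n
    +-homo (+ m)    -[1+ n ] = ⊖-homo m (suc n)
    +-homo -[1+ m ] (+ n)    = trans (⊖-homo n (suc m)) (+-comm _ _)
    +-homo -[1+ m ] -[1+ n ] = begin
      - (suc (suc (m ℕ.+ n)) ×ₙ 1#)    ≡⟨ ≡.cong (λ k → - (k ×ₙ 1#)) (ℕ.+-suc (suc m) n) ⟨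
      - ((suc m ℕ.+ suc n) ×ₙ 1#)      ≈⟨ -‿cong (×-homo-+ 1# (suc m) (suc n)) ⟩
      - (suc m ×ₙ 1# + suc n ×ₙ 1#)     ≈⟨ -‿+-comm _ _ ⟨
      - (suc m ×ₙ 1#) + - (suc n ×ₙ 1#) ∎

    -‿homo : ∀ i → ⟦ ℤ.- i ⟧ᶻ ≈ - ⟦ i ⟧ᶻ
    -‿homo (+ zero)  = sym -0#≈0#
    -‿homo (+ suc n) = refl
    -‿homo -[1+ n ]  = sym (-‿involutive _)

    ⟦_⟧ˢ : Sign → Carrier
    ⟦ Sign.+ ⟧ˢ = 1#
    ⟦ Sign.- ⟧ˢ = - 1#

    ◃-homo : ∀ s n → ⟦ s ◃ n ⟧ᶻ ≈ ⟦ s ⟧ˢ * (n ×ₙ 1#)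
    ◃-homo s       zero    = sym (zeroʳ _)
    ◃-homo Sign.+ (suc n) = sym (*-identityˡ _)
    ◃-homo Sign.- (suc n) = sym (-1*x≈-x _)

    sign-homo : ∀ s t → ⟦ s Sign.* t ⟧ˢ ≈ ⟦ s ⟧ˢ * ⟦ t ⟧ˢ
    sign-homo Sign.+ t      = sym (*-identityˡ _)
    sign-homo Sign.- Sign.+ = sym (*-identityʳ _)
    sign-homo Sign.- Sign.- = sym (trans (-1*x≈-x _) (-‿involutive _))

    *-homo : ∀ i j → ⟦ i ℤ.* j ⟧ᶻ ≈ ⟦ i ⟧ᶻ * ⟦ j ⟧ᶻ
    *-homo i j = begin
      ⟦ (sign i Sign.* sign j) ◃ (∣ i ∣ ℕ.* ∣ j ∣) ⟧ᶻ
        ≈⟨ ◃-homo (sign i Sign.* sign j) (∣ i ∣ ℕ.* ∣ j ∣) ⟩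
      ⟦ sign i Sign.* sign j ⟧ˢ * ((∣ i ∣ ℕ.* ∣ j ∣) ×ₙ 1#)
        ≈⟨ *-cong (sign-homo (sign i) (sign j)) (×1-homo-* ∣ i ∣ ∣ j ∣) ⟩
      (⟦ sign i ⟧ˢ * ⟦ sign j ⟧ˢ) * ((∣ i ∣ ×ₙ 1#) * (∣ j ∣ ×ₙ 1#))
        ≈⟨ *-interchange _ _ _ _ ⟩
      (⟦ sign i ⟧ˢ * (∣ i ∣ ×ₙ 1#)) * (⟦ sign j ⟧ˢ * (∣ j ∣ ×ₙ 1#))
        ≈⟨ *-cong (◃-homo (sign i) ∣ i ∣) (◃-homo (sign j) ∣ j ∣) ⟨
      ⟦ sign i ◃ ∣ i ∣ ⟧ᶻ * ⟦ sign j ◃ ∣ j ∣ ⟧ᶻ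
        ≡⟨ ≡.cong₂ (λ i j → ⟦ i ⟧ᶻ * ⟦ j ⟧ᶻ) (ℤ.◃-inverse i) (ℤ.◃-inverse j) ⟩
      ⟦ i ⟧ᶻ * ⟦ j ⟧ᶻ ∎

  ℤ⟶R : ℤ.+-*-rawRing -Raw-AlmostCommutative⟶ fromCommutativeRing R
  ℤ⟶R = record
    { ⟦_⟧ = ⟦_⟧ᶻ ; +-homo = +-homo ; *-homo = *-homo ; -‿homo = -‿homo
    ; 0-homo = refl ; 1-homo = refl }

  private
    _≟ᶜ_ : ∀ i j → Maybe (⟦ i ⟧ᶻ ≈ ⟦ j ⟧ᶻ)
    i ≟ᶜ j with i ℤ.≟ j
    ... | yes ≡.refl = just refl
    ... | no _       = nothing

  open import Algebra.Solver.Ring ℤ.+-*-rawRing (fromCommutativeRing R) ℤ⟶R _≟ᶜ_ public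

-- m₂ x y z t is the matrix [[y, x], [t, z]]; the fields follow the order X, Y, Z, T.
record M₂ {a} (A : Set a) : Set a where
  constructor m₂
  field x y z t : A
open M₂

-- Stated over an arbitrary raw ring so that the same expressions can be
-- built from solver polynomials.
module M₂-Ops {a ℓ} (R : RawRing a ℓ) where
  open RawRing R

  infixl 7 _·_
  infixr 8 _∙_ _∙²_
  infixl 6 _⊕_ _⊝_ _+²_
  infixr 6.5 _⊳_
  infix 4 _≈ₘ_ _≈²_

  _·_ : Op₂ (M₂ Carrier)
  u · v = m₂ (y u * x v + x u * z v) (y u * y v + x u * t v)
             (t u * x v + z u * z v) (t u * y v + z u * t v)

  _⊕_ : Op₂ (M₂ Carrier)
  u ⊕ v = m₂ (x u + x v) (y u + y v) (z u + z v) (t u + t v)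

  _∙_ : Carrier → M₂ Carrier → M₂ Carrier
  s ∙ u = m₂ (s * x u) (s * y u) (s * z u) (s * t u)

  _⊝_ : Op₂ (M₂ Carrier)
  u ⊝ v = u ⊕ (- 1#) ∙ v

  scalar : Carrier → M₂ Carrier
  scalar s = m₂ 0# s s 0#

  sl₃ : Carrier → Carrier → Carrier → M₂ Carrier
  sl₃ p q r = m₂ p q (- q) r

  sl : M₂ Carrier → M₂ Carrier
  sl u = sl₃ (x u) (y u) (t u)

  tr : M₂ Carrier → Carrier
  tr u = y u + z u

  det : M₂ Carrier → Carrier
  det u = y u * z u + - (x u * t u)

  -- equals tr (u · v) for traceless u and v; vertexwise it is Ψ
  ψ : M₂ Carrier → M₂ Carrier → Carrier
  ψ u v = ((1# + 1#) * (y u * y v) + x u * t v) + x v * t u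

  τ : M₂ Carrier → M₂ Carrier → M₂ Carrier → Carrier
  τ u v w = tr ((sl u · sl v) · sl w)

  _⊳_ : M₂ Carrier → Carrier × Carrier → Carrier × Carrier
  u ⊳ (p , q) = (y u * p + x u * q , t u * p + z u * q)

  _+²_ : Op₂ (Carrier × Carrier)
  (p , q) +² (p′ , q′) = (p + p′ , q + q′)

  _∙²_ : Carrier → Carrier × Carrier → Carrier × Carrier
  s ∙² (p , q) = (s * p , s * q)

  _≈ₘ_ : M₂ Carrier → M₂ Carrier → Set ℓ
  u ≈ₘ v = (x u ≈ x v) × (y u ≈ y v) × (z u ≈ z v) × (t u ≈ t v)

  _≈²_ : Carrier × Carrier → Carrier × Carrier → Set ℓ
  (p , q) ≈² (p′ , q′) = (p ≈ p′) × (q ≈ q′)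

module _ {c ℓ} (R : CommutativeRing c ℓ) where
  open CommutativeRing R hiding (zero) renaming (Carrier to F)
  open Over R hiding (det) renaming (sum to sumᵈ)
  open M₂-Ops rawRing
  open IntegerCoefficientSolver R using (solve; _:=_; _:+_; _:*_; :-_; _:-_; con; Polynomial)
  open import Algebra.Properties.Semiring.Sum semiring
    using (sum; sum-cong-≋; sum-replicate-zero; sum-remove; ∑-distrib-+; ∑-comm;
           *-distribˡ-sum; *-distribʳ-sum)
  open import Algebra.Properties.Ring ring using (-1*x≈-x; -0#≈0#)
  open import Algebra.Properties.Group +-group using (inverseˡ-unique; inverseʳ-unique; x∙y⁻¹≈ε⇒x≈y)
  open import Algebra.Properties.CommutativeSemigroup +-commutativeSemigroup
    using () renaming (interchange to +-interchange)
  open import Algebra.Properties.CommutativeSemigroup *-commutativeSemigroup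
    using () renaming (x∙yz≈y∙xz to *-leftSwap)
  open import Relation.Binary.Reasoning.Setoid setoid

  polynomials : ℕ → RawRing 0ℓ 0ℓ
  polynomials n = record
    { Carrier = Polynomial n ; _≈_ = _≡_ ; _+_ = _:+_ ; _*_ = _:*_ ; -_ = :-_
    ; 0# = con (+ 0) ; 1# = con (+ 1) }

  module P {n} = M₂-Ops (polynomials n)

  Equation : (n : ℕ) → Set (N-ary-level 0ℓ 0ℓ n)
  Equation n = N-ary n (Polynomial n) (Polynomial n × Polynomial n)

  -- Identities of 2 × 2 matrices

  anticommutator : ∀ u v → sl u · sl v ⊕ sl v · sl u ≈ₘ scalar (ψ u v)
  anticommutator (m₂ a b _ d) (m₂ a′ b′ _ d′) =
      solve 6 (E x) refl a b d a′ b′ d′ , solve 6 (E y) refl a b d a′ b′ d′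
    , solve 6 (E z) refl a b d a′ b′ d′ , solve 6 (E t) refl a b d a′ b′ d′
    where
    E : (M₂ (Polynomial 6) → Polynomial 6) → Equation 6
    E π a b d a′ b′ d′ = let u = P.sl₃ a b d ; v = P.sl₃ a′ b′ d′ in
      π (u P.· v P.⊕ v P.· u) := π (P.scalar (P.ψ u v))

  triple-difference : ∀ u v w →
    (sl u · sl v) · sl w ⊝ (sl w · sl v) · sl u ≈ₘ scalar (τ u v w)
  triple-difference (m₂ a b _ d) (m₂ a′ b′ _ d′) (m₂ a″ b″ _ d″) =
      solve 9 (E x) refl a b d a′ b′ d′ a″ b″ d″ , solve 9 (E y) refl a b d a′ b′ d′ a″ b″ d″
    , solve 9 (E z) refl a b d a′ b′ d′ a″ b″ d″ , solve 9 (E t) refl a b d a′ b′ d′ a″ b″ d″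
    where
    E : (M₂ (Polynomial 9) → Polynomial 9) → Equation 9
    E π a b d a′ b′ d′ a″ b″ d″ =
      let u = P.sl₃ a b d ; v = P.sl₃ a′ b′ d′ ; w = P.sl₃ a″ b″ d″ in
      π ((u P.· v) P.· w P.⊝ (w P.· v) P.· u) :=
      π (P.scalar (P.tr ((u P.· v) P.· w)))

  frame-expansion : ∀ u v w →
    (ψ v w * ψ v w - ψ v v * ψ w w) ∙ sl u ≈ₘ
      τ u v w ∙ (sl v · sl w ⊝ sl w · sl v)
        ⊕ ψ u w ∙ (ψ v w ∙ sl v ⊝ ψ v v ∙ sl w)
        ⊕ ψ u v ∙ (ψ v w ∙ sl w ⊝ ψ w w ∙ sl v)
  frame-expansion (m₂ a b _ d) (m₂ a′ b′ _ d′) (m₂ a″ b″ _ d″) =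
      solve 9 (E x) refl a b d a′ b′ d′ a″ b″ d″ , solve 9 (E y) refl a b d a′ b′ d′ a″ b″ d″
    , solve 9 (E z) refl a b d a′ b′ d′ a″ b″ d″ , solve 9 (E t) refl a b d a′ b′ d′ a″ b″ d″
    where
    E : (M₂ (Polynomial 9) → Polynomial 9) → Equation 9
    E π a b d a′ b′ d′ a″ b″ d″ =
      let u = P.sl₃ a b d ; v = P.sl₃ a′ b′ d′ ; w = P.sl₃ a″ b″ d″ in
      π ((P.ψ v w :* P.ψ v w :+ :- (P.ψ v v :* P.ψ w w)) P.∙ u) :=
      π (P.tr ((u P.· v) P.· w) P.∙ (v P.· w P.⊝ w P.· v)
           P.⊕ P.ψ u w P.∙ (P.ψ v w P.∙ v P.⊝ P.ψ v v P.∙ w)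
           P.⊕ P.ψ u v P.∙ (P.ψ v w P.∙ w P.⊝ P.ψ w w P.∙ v))

  ψ-self : ∀ u → ψ u u ≈ - (det (sl u) + det (sl u))
  ψ-self (m₂ a b _ d) = solve 3 (λ a b d → let u = P.sl₃ a b d in
    P.ψ u u := :- (P.det u :+ P.det u)) refl a b d

  ⊳-· : ∀ u v p → u ⊳ v ⊳ p ≈² (u · v) ⊳ p
  ⊳-· (m₂ a b c d) (m₂ a′ b′ c′ d′) (p , q) =
      solve 10 (E proj₁) refl a b c d a′ b′ c′ d′ p q
    , solve 10 (E proj₂) refl a b c d a′ b′ c′ d′ p q
    where
    E : (Polynomial 10 × Polynomial 10 → Polynomial 10) → Equation 10
    E π a b c d a′ b′ c′ d′ p q = let u = m₂ a b c d ; v = m₂ a′ b′ c′ d′ in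
      π (u P.⊳ v P.⊳ (p , q)) := π ((u P.· v) P.⊳ (p , q))

  ⊳-⊕ : ∀ u v p → u ⊳ p +² v ⊳ p ≈² (u ⊕ v) ⊳ p
  ⊳-⊕ (m₂ a b c d) (m₂ a′ b′ c′ d′) (p , q) =
      solve 10 (E proj₁) refl a b c d a′ b′ c′ d′ p q
    , solve 10 (E proj₂) refl a b c d a′ b′ c′ d′ p q
    where
    E : (Polynomial 10 × Polynomial 10 → Polynomial 10) → Equation 10
    E π a b c d a′ b′ c′ d′ p q = let u = m₂ a b c d ; v = m₂ a′ b′ c′ d′ in
      π (u P.⊳ (p , q) P.+² v P.⊳ (p , q)) := π ((u P.⊕ v) P.⊳ (p , q))

  ⊳-∙ : ∀ s u p → s ∙² (u ⊳ p) ≈² (s ∙ u) ⊳ p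
  ⊳-∙ s (m₂ a b c d) (p , q) =
    solve 7 (E proj₁) refl s a b c d p q , solve 7 (E proj₂) refl s a b c d p q
    where
    E : (Polynomial 7 × Polynomial 7 → Polynomial 7) → Equation 7
    E π s a b c d p q =
      π (s P.∙² (m₂ a b c d P.⊳ (p , q))) := π ((s P.∙ m₂ a b c d) P.⊳ (p , q))

  ⊳-cong : ∀ {u v p q} → u ≈ₘ v → p ≈² q → u ⊳ p ≈² v ⊳ q
  ⊳-cong (x≈ , y≈ , z≈ , t≈) (p≈ , q≈) =
    +-cong (*-cong y≈ p≈) (*-cong x≈ q≈) , +-cong (*-cong t≈ p≈) (*-cong z≈ q≈)

  traceless⇒≈sl : ∀ {u} → tr u ≈ 0# → u ≈ₘ sl u
  traceless⇒≈sl tr≈0 = refl , refl , inverseʳ-unique _ _ tr≈0 , refl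

  *-cancelʳ-≈0 : IsField → ∀ {a b} → a * b ≈ 0# → ¬ (b ≈ 0#) → a ≈ 0#
  *-cancelʳ-≈0 (_ , inverse) {a} {b} ab≈0 b≉0 with inverse b b≉0
  ... | b⁻¹ , bb⁻¹≈1 = begin
    a              ≈⟨ *-identityʳ a ⟨
    a * 1#         ≈⟨ *-congˡ bb⁻¹≈1 ⟨
    a * (b * b⁻¹)  ≈⟨ *-assoc a b b⁻¹ ⟨
    (a * b) * b⁻¹  ≈⟨ *-congʳ ab≈0 ⟩
    0# * b⁻¹       ≈⟨ zeroˡ b⁻¹ ⟩
    0#             ∎

  hasCard⇒≈? : ∀ {q} → HasCard q → ∀ a b → Dec (a ≈ b)
  hasCard⇒≈? (enum , injective , surjective) a b with surjective a | surjective b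
  ... | i , enumᵢ≈a | j , enumⱼ≈b with i ≟ j
  ...   | yes ≡.refl = yes (trans (sym enumᵢ≈a) enumⱼ≈b)
  ...   | no  i≢j    =
    no (λ a≈b → i≢j (injective i j (trans enumᵢ≈a (trans a≈b (sym enumⱼ≈b)))))

  sumᵈ≡sum : ∀ {n} (v : Vec n) → sumᵈ v ≡ sum v
  sumᵈ≡sum {zero}  v = ≡.refl
  sumᵈ≡sum {suc n} v = ≡.cong (_+_ (v zero)) (sumᵈ≡sum (λ k → v (suc k)))

  ∑-zero : ∀ {n} {f : Vec n} → (∀ k → f k ≈ 0#) → sum f ≈ 0#
  ∑-zero {n} f≈0 = trans (sum-cong-≋ f≈0) (sum-replicate-zero n)

  ∑-distrib-- : ∀ {n} (f h : Vec n) → sum (λ k → f k - h k) ≈ sum f - sum h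
  ∑-distrib-- f h = begin
    sum (λ k → f k - h k)          ≈⟨ ∑-distrib-+ f (λ k → - h k) ⟩
    sum f + sum (λ k → - h k)      ≈⟨ +-congˡ (sum-cong-≋ (λ k → -1*x≈-x (h k))) ⟨
    sum f + sum (λ k → - 1# * h k) ≈⟨ +-congˡ (*-distribˡ-sum (- 1#) h) ⟨
    sum f + - 1# * sum h           ≈⟨ +-congˡ (-1*x≈-x (sum h)) ⟩
    sum f - sum h                  ∎

  e-diagonal : ∀ {n} (i : Fin n) → e i i ≈ 1#
  e-diagonal i with i ≟ i
  ... | yes _   = refl
  ... | no i≢i = contradiction ≡.refl i≢i

  e-offDiagonal : ∀ {n} {i j : Fin n} → ¬ (i ≡ j) → e i j ≈ 0#
  e-offDiagonal {i = i} {j} i≢j with i ≟ j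
  ... | yes i≡j = contradiction i≡j i≢j
  ... | no _    = refl

  ∑-sift : ∀ {n} (f : Vec n) (i : Fin n) → sum (λ k → f k * e i k) ≈ f i
  ∑-sift {suc n} f i = begin
    sum (λ k → f k * e i k)
      ≈⟨ sum-remove {i = i} (λ k → f k * e i k) ⟩
    f i * e i i + sum (λ s → f (punchIn i s) * e i (punchIn i s))
      ≈⟨ +-cong (*-congˡ (e-diagonal i)) (∑-zero (λ s → off (punchIn i s) (punchInᵢ≢i i s))) ⟩
    f i * 1# + 0#  ≈⟨ +-identityʳ _ ⟩
    f i * 1#       ≈⟨ *-identityʳ _ ⟩
    f i            ∎
    where
    off : ∀ k → ¬ (k ≡ i) → f k * e i k ≈ 0#
    off k k≢i = trans (*-congˡ (e-offDiagonal (k≢i ∘ ≡.sym))) (zeroʳ _)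

  ⟨⟩-×ᵥe : ∀ {n} (v a : Vec n) j → ⟨ v , a ×ᵥ e j ⟩ ≈ v j * a j
  ⟨⟩-×ᵥe v a j = begin
    ⟨ v , a ×ᵥ e j ⟩                ≡⟨ sumᵈ≡sum (v ×ᵥ (a ×ᵥ e j)) ⟩
    sum (λ k → v k * (a k * e j k)) ≈⟨ sum-cong-≋ (λ k → *-assoc (v k) (a k) (e j k)) ⟨
    sum (λ k → (v k * a k) * e j k) ≈⟨ ∑-sift (λ k → v k * a k) j ⟩
    v j * a j                       ∎

  ⟨⟩-e×ᵥ : ∀ {n} (v a : Vec n) i → ⟨ v , e i ×ᵥ a ⟩ ≈ v i * a i
  ⟨⟩-e×ᵥ v a i = begin
    ⟨ v , e i ×ᵥ a ⟩                ≡⟨ sumᵈ≡sum (v ×ᵥ (e i ×ᵥ a)) ⟩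
    sum (λ k → v k * (e i k * a k)) ≈⟨ sum-cong-≋ (λ k → *-congˡ (*-comm (e i k) (a k))) ⟩
    sum (λ k → v k * (a k * e i k)) ≈⟨ sum-cong-≋ (λ k → *-assoc (v k) (a k) (e i k)) ⟨
    sum (λ k → (v k * a k) * e i k) ≈⟨ ∑-sift (λ k → v k * a k) i ⟩
    v i * a i                       ∎

  ∑-annihilates : ∀ {m d} (w : Fin m → F) (v : Fin m → Fin d → F) (β : Fin d → F) →
    (∀ i → sum (λ r → w r * v r i) ≈ 0#) → sum (λ r → w r * sum (λ i → v r i * β i)) ≈ 0#
  ∑-annihilates w v β relation = begin
    sum (λ r → w r * sum (λ i → v r i * β i))
      ≈⟨ sum-cong-≋ (λ r → *-distribˡ-sum (w r) (λ i → v r i * β i)) ⟩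
    sum (λ r → sum (λ i → w r * (v r i * β i)))
      ≈⟨ ∑-comm (λ r i → w r * (v r i * β i)) ⟩
    sum (λ i → sum (λ r → w r * (v r i * β i)))
      ≈⟨ sum-cong-≋ (λ i → sum-cong-≋ (λ r → *-assoc (w r) (v r i) (β i))) ⟨
    sum (λ i → sum (λ r → (w r * v r i) * β i))
      ≈⟨ sum-cong-≋ (λ i → *-distribʳ-sum (β i) (λ r → w r * v r i)) ⟨
    sum (λ i → sum (λ r → w r * v r i) * β i)
      ≈⟨ ∑-zero (λ i → trans (*-congʳ (relation i)) (zeroˡ (β i))) ⟩
    0# ∎

  -- Stabilisers of the graph of -G

  infixr 7 _⊛_
  _⊛_ : ∀ {n} → (Fin n → Fin n → F) → Vec n → Vec n
  (g ⊛ u) i = sum (λ j → g i j * u j)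

  InGraph : ∀ {n} → (Fin n → Fin n → F) → (Fin n → F × F) → Set ℓ
  InGraph g p = ∀ i → proj₂ (p i) + (g ⊛ (proj₁ ∘ p)) i ≈ 0#

  Stabilises : ∀ {n} → (Fin n → Fin n → F) → (Fin n → M₂ F) → Set (c ⊔ ℓ)
  Stabilises g A = ∀ p → InGraph g p → InGraph g (λ k → A k ⊳ p k)

  module _ {n} {g : Fin n → Fin n → F} where

    inGraph-cong : ∀ {p q} → (∀ k → p k ≈² q k) → InGraph g p → InGraph g q
    inGraph-cong p≈q p∈ i =
      trans (sym (+-cong (proj₂ (p≈q i)) (sum-cong-≋ (λ j → *-congˡ (proj₁ (p≈q j)))))) (p∈ i)

    inGraph-+² : ∀ {p q} → InGraph g p → InGraph g q → InGraph g (λ k → p k +² q k)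
    inGraph-+² {p} {q} p∈ q∈ i = begin
      (proj₂ (p i) + proj₂ (q i)) + sum (λ j → g i j * (proj₁ (p j) + proj₁ (q j)))
        ≈⟨ +-congˡ (trans (sum-cong-≋ (λ j → distribˡ (g i j) _ _))
                          (∑-distrib-+ (λ j → g i j * proj₁ (p j)) (λ j → g i j * proj₁ (q j)))) ⟩
      (proj₂ (p i) + proj₂ (q i)) + ((g ⊛ (proj₁ ∘ p)) i + (g ⊛ (proj₁ ∘ q)) i)
        ≈⟨ +-interchange _ _ _ _ ⟩
      (proj₂ (p i) + (g ⊛ (proj₁ ∘ p)) i) + (proj₂ (q i) + (g ⊛ (proj₁ ∘ q)) i)
        ≈⟨ +-cong (p∈ i) (q∈ i) ⟩
      0# + 0#
        ≈⟨ +-identityʳ 0# ⟩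
      0# ∎

    inGraph-∙² : ∀ s {p} → InGraph g p → InGraph g (λ k → s ∙² p k)
    inGraph-∙² s {p} p∈ i = begin
      s * proj₂ (p i) + sum (λ j → g i j * (s * proj₁ (p j)))
        ≈⟨ +-congˡ (trans (sum-cong-≋ (λ j → *-leftSwap (g i j) s _))
                          (sym (*-distribˡ-sum s (λ j → g i j * proj₁ (p j))))) ⟩
      s * proj₂ (p i) + s * (g ⊛ (proj₁ ∘ p)) i  ≈⟨ distribˡ s _ _ ⟨
      s * (proj₂ (p i) + (g ⊛ (proj₁ ∘ p)) i)    ≈⟨ *-congˡ (p∈ i) ⟩
      s * 0#                                     ≈⟨ zeroʳ s ⟩
      0#                                         ∎

    graph-parametrises : ∀ {p} → InGraph g p →
      ∀ k → (proj₁ (p k) , - (g ⊛ (proj₁ ∘ p)) k) ≈² p k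
    graph-parametrises p∈ k = refl , sym (inverseˡ-unique _ _ (p∈ k))

    stabilises-cong : ∀ {A B} → (∀ k → A k ≈ₘ B k) → Stabilises g A → Stabilises g B
    stabilises-cong A≈B A-stab p p∈ =
      inGraph-cong (λ k → ⊳-cong (A≈B k) (refl , refl)) (A-stab p p∈)

    stabilises-· : ∀ {A B} → Stabilises g A → Stabilises g B → Stabilises g (λ k → A k · B k)
    stabilises-· {A} {B} A-stab B-stab p p∈ =
      inGraph-cong (λ k → ⊳-· (A k) (B k) (p k)) (A-stab _ (B-stab p p∈))

    stabilises-⊕ : ∀ {A B} → Stabilises g A → Stabilises g B → Stabilises g (λ k → A k ⊕ B k)
    stabilises-⊕ {A} {B} A-stab B-stab p p∈ =
      inGraph-cong (λ k → ⊳-⊕ (A k) (B k) (p k)) (inGraph-+² (A-stab p p∈) (B-stab p p∈))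

    stabilises-∙ : ∀ s {A} → Stabilises g A → Stabilises g (λ k → s ∙ A k)
    stabilises-∙ s {A} A-stab p p∈ =
      inGraph-cong (λ k → ⊳-∙ s (A k) (p k)) (inGraph-∙² s (A-stab p p∈))

    stabilises-⊝ : ∀ {A B} → Stabilises g A → Stabilises g B → Stabilises g (λ k → A k ⊝ B k)
    stabilises-⊝ A-stab B-stab = stabilises-⊕ A-stab (stabilises-∙ (- 1#) B-stab)

    scalar-constant : IsField → Connected g → ∀ {s : Vec n} →
      Stabilises g (λ k → scalar (s k)) → ∀ i j → s i ≈ s j
    scalar-constant isField connected {s} s-stab i j = along (connected i j)
      where
      -- test the graph condition on the image of (e j, -G e j)
      edge : ∀ {i j} → ¬ (g i j ≈ 0#) → s i ≈ s j
      edge {i} {j} g≉0 = sym (x∙y⁻¹≈ε⇒x≈y _ _ (*-cancelʳ-≈0 isField (begin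
        (s j - s i) * g i j
          ≈⟨ solve 4 (λ sj si gij eji → (sj :+ :- si) :* gij :=
               (con (+ 0) :* eji :+ si :* :- gij) :+ gij :* sj) refl (s j) (s i) (g i j) (e j i) ⟩
        (0# * e j i + s i * - g i j) + g i j * s j
          ≈⟨ +-congˡ sifted ⟨
        (0# * e j i + s i * - g i j) + sum (λ k → g i k * (s k * e j k + 0# * - g k j))
          ≈⟨ s-stab (λ k → e j k , - g k j) column∈ i ⟩
        0# ∎) g≉0))
        where
        column∈ : InGraph g (λ k → e j k , - g k j)
        column∈ i′ = trans (+-congˡ (∑-sift (g i′) j)) (-‿inverseˡ (g i′ j))
        sifted : sum (λ k → g i k * (s k * e j k + 0# * - g k j)) ≈ g i j * s j
        sifted = trans (sum-cong-≋ (λ k → solve 4 (λ gik sk ejk gkj →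
                          gik :* (sk :* ejk :+ con (+ 0) :* :- gkj) := (gik :* sk) :* ejk)
                        refl (g i k) (s k) (e j k) (g k j)))
                       (∑-sift (λ k → g i k * s k) j)
      along : ∀ {i j} → Walk g i j → s i ≈ s j
      along here            = refl
      along (step g≉0 walk) = trans (edge g≉0) (along walk)

  mat : ∀ {n} → Quad n → Fin n → M₂ F
  mat φ k = m₂ (X φ k) (Y φ k) (Z φ k) (T φ k)

  -- the defining equations of Λ(G,G) at (i, k), contracted against u k
  module Contraction {n} {g : Fin n → Fin n → F} (g-sym : ∀ i j → g i j ≈ g j i)
                     (v u : Vec n) (i : Fin n) where

    g×g : sum (λ k → ⟨ v , g i ×ᵥ g k ⟩ * u k) ≈ sum (λ j → g i j * (v j * (g ⊛ u) j))
    g×g = begin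
      sum (λ k → ⟨ v , g i ×ᵥ g k ⟩ * u k)
        ≈⟨ sum-cong-≋ (λ k → *-congʳ (reflexive (sumᵈ≡sum (v ×ᵥ (g i ×ᵥ g k))))) ⟩
      sum (λ k → sum (λ j → v j * (g i j * g k j)) * u k)
        ≈⟨ sum-cong-≋ (λ k → *-distribʳ-sum (u k) (λ j → v j * (g i j * g k j))) ⟩
      sum (λ k → sum (λ j → (v j * (g i j * g k j)) * u k))
        ≈⟨ ∑-comm (λ k j → (v j * (g i j * g k j)) * u k) ⟩
      sum (λ j → sum (λ k → (v j * (g i j * g k j)) * u k))
        ≈⟨ sum-cong-≋ (λ j → sum-cong-≋ (λ k → regroup j k)) ⟩
      sum (λ j → sum (λ k → (g i j * v j) * (g j k * u k)))
        ≈⟨ sum-cong-≋ (λ j → *-distribˡ-sum (g i j * v j) (λ k → g j k * u k)) ⟨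
      sum (λ j → (g i j * v j) * (g ⊛ u) j)
        ≈⟨ sum-cong-≋ (λ j → *-assoc (g i j) (v j) _) ⟩
      sum (λ j → g i j * (v j * (g ⊛ u) j)) ∎
      where
      regroup : ∀ j k → (v j * (g i j * g k j)) * u k ≈ (g i j * v j) * (g j k * u k)
      regroup j k = trans (*-congʳ (*-congˡ (*-congˡ (g-sym k j))))
        (solve 4 (λ vj gij gjk uk → (vj :* (gij :* gjk)) :* uk := (gij :* vj) :* (gjk :* uk))
           refl (v j) (g i j) (g j k) (u k))

    g×e : sum (λ k → ⟨ v , g i ×ᵥ e k ⟩ * u k) ≈ sum (λ j → g i j * (v j * u j))
    g×e = sum-cong-≋ (λ k → trans (*-congʳ (⟨⟩-×ᵥe v (g i) k))
      (solve 3 (λ vk gik uk → (vk :* gik) :* uk := gik :* (vk :* uk)) refl (v k) (g i k) (u k)))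

    e×g : sum (λ k → ⟨ v , e i ×ᵥ g k ⟩ * u k) ≈ v i * (g ⊛ u) i
    e×g = begin
      sum (λ k → ⟨ v , e i ×ᵥ g k ⟩ * u k)
        ≈⟨ sum-cong-≋ (λ k → *-congʳ (⟨⟩-e×ᵥ v (g k) i)) ⟩
      sum (λ k → (v i * g k i) * u k)
        ≈⟨ sum-cong-≋ (λ k → trans (*-congʳ (*-congˡ (g-sym k i))) (*-assoc (v i) (g i k) (u k))) ⟩
      sum (λ k → v i * (g i k * u k))
        ≈⟨ *-distribˡ-sum (v i) (λ k → g i k * u k) ⟨
      v i * (g ⊛ u) i ∎

    e×e : sum (λ k → ⟨ v , e i ×ᵥ e k ⟩ * u k) ≈ v i * u i
    e×e = begin
      sum (λ k → ⟨ v , e i ×ᵥ e k ⟩ * u k)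
        ≈⟨ sum-cong-≋ (λ k → *-congʳ (⟨⟩-×ᵥe v (e i) k)) ⟩
      sum (λ k → (v k * e i k) * u k)
        ≈⟨ sum-cong-≋ (λ k → solve 3 (λ vk eik uk → (vk :* eik) :* uk := (vk :* uk) :* eik)
                                refl (v k) (e i k) (u k)) ⟩
      sum (λ k → (v k * u k) * e i k)
        ≈⟨ ∑-sift (λ k → v k * u k) i ⟩
      v i * u i ∎

  Λ⇒stabilises : ∀ {n} {g : Fin n → Fin n → F} → (∀ i j → g i j ≈ g j i) →
    ∀ {φ} → InΛ g φ → Stabilises g (mat φ)
  Λ⇒stabilises {n} {g} g-sym {φ} φ∈Λ p p∈ =
    inGraph-cong (λ k → ⊳-cong (refl , refl , refl , refl) (graph-parametrises p∈ k))
                 (graph-image (proj₁ ∘ p))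
    where
    N : Fin n → Fin n → F
    N i k = ((⟨ X φ , g i ×ᵥ g k ⟩ - ⟨ Y φ , g i ×ᵥ e k ⟩) + ⟨ Z φ , e i ×ᵥ g k ⟩)
              - ⟨ T φ , e i ×ᵥ e k ⟩

    contracted : ∀ u i → sum (λ k → N i k * u k) ≈
      ((sum (λ j → g i j * (X φ j * (g ⊛ u) j)) - sum (λ j → g i j * (Y φ j * u j)))
         + Z φ i * (g ⊛ u) i) - T φ i * u i
    contracted u i = begin
      sum (λ k → N i k * u k)
        ≈⟨ sum-cong-≋ (λ k → solve 5 (λ a b c d uk → (((a :- b) :+ c) :- d) :* uk :=
             ((a :* uk :- b :* uk) :+ c :* uk) :- d :* uk) refl (A k) (B k) (C k) (D k) (u k)) ⟩
      sum (λ k → ((A k * u k - B k * u k) + C k * u k) - D k * u k)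
        ≈⟨ ∑-distrib-- (λ k → (A k * u k - B k * u k) + C k * u k) (λ k → D k * u k) ⟩
      sum (λ k → (A k * u k - B k * u k) + C k * u k) - sum (λ k → D k * u k)
        ≈⟨ +-congʳ (∑-distrib-+ (λ k → A k * u k - B k * u k) (λ k → C k * u k)) ⟩
      (sum (λ k → A k * u k - B k * u k) + sum (λ k → C k * u k)) - sum (λ k → D k * u k)
        ≈⟨ +-congʳ (+-congʳ (∑-distrib-- (λ k → A k * u k) (λ k → B k * u k))) ⟩
      ((sum (λ k → A k * u k) - sum (λ k → B k * u k)) + sum (λ k → C k * u k))
        - sum (λ k → D k * u k)
        ≈⟨ +-cong (+-cong (+-cong (C.g×g (X φ)) (-‿cong (C.g×e (Y φ)))) (C.e×g (Z φ)))
                  (-‿cong (C.e×e (T φ))) ⟩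
      ((sum (λ j → g i j * (X φ j * (g ⊛ u) j)) - sum (λ j → g i j * (Y φ j * u j)))
         + Z φ i * (g ⊛ u) i) - T φ i * u i ∎
      where
      module C v = Contraction g-sym v u i
      A B C D : Vec n
      A k = ⟨ X φ , g i ×ᵥ g k ⟩
      B k = ⟨ Y φ , g i ×ᵥ e k ⟩
      C k = ⟨ Z φ , e i ×ᵥ g k ⟩
      D k = ⟨ T φ , e i ×ᵥ e k ⟩

    graph-image : ∀ u → InGraph g (λ k → mat φ k ⊳ (u k , - (g ⊛ u) k))
    graph-image u i = begin
      (T φ i * u i + Z φ i * - Gu i) + sum (λ j → g i j * (Y φ j * u j + X φ j * - Gu j))
        ≈⟨ +-congˡ (trans (sum-cong-≋ split)
                    (∑-distrib-- (λ j → g i j * (Y φ j * u j)) (λ j → g i j * (X φ j * Gu j)))) ⟩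
      (T φ i * u i + Z φ i * - Gu i) + (sum (λ j → g i j * (Y φ j * u j))
                                          - sum (λ j → g i j * (X φ j * Gu j)))
        ≈⟨ solve 5 (λ tu z gu q p → (tu :+ z :* :- gu) :+ (q :- p) :=
                                    :- (((p :- q) :+ z :* gu) :- tu))
             refl (T φ i * u i) (Z φ i) (Gu i) _ _ ⟩
      - (((sum (λ j → g i j * (X φ j * Gu j)) - sum (λ j → g i j * (Y φ j * u j)))
           + Z φ i * Gu i) - T φ i * u i)
        ≈⟨ -‿cong (contracted u i) ⟨
      - sum (λ k → N i k * u k)
        ≈⟨ -‿cong (∑-zero (λ k → trans (*-congʳ (φ∈Λ i k)) (zeroˡ (u k)))) ⟩
      - 0#
        ≈⟨ -0#≈0# ⟩
      0# ∎
      where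
      Gu = g ⊛ u
      split : ∀ j → g i j * (Y φ j * u j + X φ j * - Gu j) ≈
                    g i j * (Y φ j * u j) - g i j * (X φ j * Gu j)
      split j = solve 5 (λ gij yj uj xj guj → gij :* (yj :* uj :+ xj :* :- guj) :=
                           gij :* (yj :* uj) :- gij :* (xj :* guj))
                  refl (g i j) (Y φ j) (u j) (X φ j) (Gu j)

  module Constancy {n} {g : Fin n → Fin n → F} (isField : IsField) (connected : Connected g) where

    ψ-constant : ∀ {A B : Fin n → M₂ F} → Stabilises g (sl ∘ A) → Stabilises g (sl ∘ B) →
      ∀ i j → ψ (A i) (B i) ≈ ψ (A j) (B j)
    ψ-constant {A} {B} A-stab B-stab = scalar-constant isField connected
      (stabilises-cong (λ k → anticommutator (A k) (B k))
        (stabilises-⊕ (stabilises-· A-stab B-stab) (stabilises-· B-stab A-stab)))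

    τ-constant : ∀ {A B C : Fin n → M₂ F} →
      Stabilises g (sl ∘ A) → Stabilises g (sl ∘ B) → Stabilises g (sl ∘ C) →
      ∀ i j → τ (A i) (B i) (C i) ≈ τ (A j) (B j) (C j)
    τ-constant {A} {B} {C} A-stab B-stab C-stab = scalar-constant isField connected
      (stabilises-cong (λ k → triple-difference (A k) (B k) (C k))
        (stabilises-⊝ (stabilises-· (stabilises-· A-stab B-stab) C-stab)
                      (stabilises-· (stabilises-· C-stab B-stab) A-stab)))

  -- Linear dependence

  module _ (isField : IsField) (_≈0? : ∀ a → Dec (a ≈ 0#)) where

    NontrivialRelation : ∀ {m d} → (Fin m → Fin d → F) → Set (c ⊔ ℓ)
    NontrivialRelation {m} v =
      ∃ λ (w : Vec m) → (∃ λ r → ¬ (w r ≈ 0#)) × (∀ i → sum (λ r → w r * v r i) ≈ 0#)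

    prependZeroColumn : ∀ {m d} {v : Fin m → Fin (suc d) → F} → (∀ r → v r zero ≈ 0#) →
      NontrivialRelation (λ r i → v r (suc i)) → NontrivialRelation v
    prependZeroColumn column≈0 (w , w≉0 , relation) = w , w≉0 , λ where
      zero    → ∑-zero (λ r → trans (*-congˡ (column≈0 r)) (zeroʳ (w r)))
      (suc i) → relation i

    -- one step of Gaussian elimination, clearing the first column with pivot row r₀
    eliminate : ∀ {m d} (v : Fin (suc m) → Fin (suc d) → F) r₀ → ¬ (v r₀ zero ≈ 0#) →
      NontrivialRelation (λ s i → v r₀ zero * v (punchIn r₀ s) (suc i)
                                   - v (punchIn r₀ s) zero * v r₀ (suc i)) →
      NontrivialRelation v
    eliminate {m} v r₀ p≉0 (μ , (s₀ , μ≉0) , relation) = w , (punchIn r₀ s₀ , w≉0) , relation′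
      where
      p : F
      p = v r₀ zero
      U : F
      U = sum (λ s → μ s * v (punchIn r₀ s) zero)
      w : Vec (suc m)
      w = insertAt (λ s → p * μ s) r₀ (- U)

      w≉0 : ¬ (w (punchIn r₀ s₀) ≈ 0#)
      w≉0 w≈0 = μ≉0 (*-cancelʳ-≈0 isField
        (trans (*-comm (μ s₀) p)
               (trans (reflexive (≡.sym (removeAt-insertAt _ r₀ (- U) s₀))) w≈0))
        p≉0)

      eliminated : ∀ i → sum (λ r → w r * v r i) ≈
        sum (λ s → μ s * (p * v (punchIn r₀ s) i - v (punchIn r₀ s) zero * v r₀ i))
      eliminated i = begin
        sum (λ r → w r * v r i)
          ≈⟨ sum-remove {i = r₀} (λ r → w r * v r i) ⟩
        w r₀ * v r₀ i + sum (λ s → w (punchIn r₀ s) * V s)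
          ≈⟨ +-cong (*-congʳ (reflexive (insertAt-lookup _ r₀ (- U))))
                    (sum-cong-≋ (λ s → *-congʳ (reflexive (removeAt-insertAt _ r₀ (- U) s)))) ⟩
        - U * v r₀ i + sum (λ s → (p * μ s) * V s)
          ≈⟨ solve 3 (λ u q S → :- u :* q :+ S := S :- u :* q) refl U (v r₀ i) _ ⟩
        sum (λ s → (p * μ s) * V s) - U * v r₀ i
          ≈⟨ +-congˡ (-‿cong (*-distribʳ-sum (v r₀ i) (λ s → μ s * v (punchIn r₀ s) zero))) ⟩
        sum (λ s → (p * μ s) * V s) - sum (λ s → (μ s * v (punchIn r₀ s) zero) * v r₀ i)
          ≈⟨ ∑-distrib-- (λ s → (p * μ s) * V s)
                         (λ s → (μ s * v (punchIn r₀ s) zero) * v r₀ i) ⟨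
        sum (λ s → (p * μ s) * V s - (μ s * v (punchIn r₀ s) zero) * v r₀ i)
          ≈⟨ sum-cong-≋ (λ s → solve 5 (λ p′ μs Vs us q →
                 (p′ :* μs) :* Vs :- (μs :* us) :* q := μs :* (p′ :* Vs :- us :* q))
               refl p (μ s) (V s) (v (punchIn r₀ s) zero) (v r₀ i)) ⟩
        sum (λ s → μ s * (p * V s - v (punchIn r₀ s) zero * v r₀ i)) ∎
        where
        V : Vec m
        V s = v (punchIn r₀ s) i

      relation′ : ∀ i → sum (λ r → w r * v r i) ≈ 0#
      relation′ zero    = trans (eliminated zero) (∑-zero (λ s → trans
        (*-congˡ (solve 2 (λ p′ us → p′ :* us :- us :* p′ := con (+ 0))
                    refl p (v (punchIn r₀ s) zero)))
        (zeroʳ (μ s))))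
      relation′ (suc i) = trans (eliminated (suc i)) (relation i)

    nontrivialRelation : ∀ {m d} → d ℕ.< m → (v : Fin m → Fin d → F) → NontrivialRelation v
    nontrivialRelation {suc m} {zero}  _            v = (λ _ → 1#) , (zero , proj₁ isField) , λ ()
    nontrivialRelation {suc m} {suc d} (ℕ.s≤s d<m) v with all? (λ r → v r zero ≈0?)
    ... | yes column≈0 = prependZeroColumn {v = v} column≈0
                           (nontrivialRelation (ℕ.m<n⇒m<1+n d<m) (λ r i → v r (suc i)))
    ... | no  column≉0 =
      let r₀ , pivot≉0 = ¬∀⟶∃¬ (suc m) _ (λ r → v r zero ≈0?) column≉0
      in  eliminate v r₀ pivot≉0 (nontrivialRelation d<m _)

  -- The Gram determinant of Ψ on Λ₀

  Ψ-self≈0 : ∀ {n} {φ : Quad n} k →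
    Y φ k + Z φ k ≈ 0# → Over.det R φ k ≈ 0# → Ψ φ φ k ≈ 0#
  Ψ-self≈0 {φ = φ} k traceless nilpotent = begin
    Ψ φ φ k                                      ≈⟨ ψ-self (mat φ k) ⟩
    - (det (sl (mat φ k)) + det (sl (mat φ k)))  ≈⟨ -‿cong (+-cong det≈0 det≈0) ⟩
    - (0# + 0#)                                  ≈⟨ -‿cong (+-identityʳ 0#) ⟩
    - 0#                                         ≈⟨ -0#≈0# ⟩
    0#                                           ∎
    where
    det≈0 : det (sl (mat φ k)) ≈ 0#
    det≈0 = trans (+-congʳ (*-congˡ (sym (inverseʳ-unique _ _ traceless)))) nilpotent

  module _ (isField : IsField) (_≈0? : ∀ a → Dec (a ≈ 0#)) {n} {g : Fin n → Fin n → F}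
           (g-sym : ∀ i j → g i j ≈ g j i) (connected : Connected g) where

    open Constancy isField connected

    Λ₀⇒stabilises-sl : ∀ {φ} → InΛ₀ g φ → Stabilises g (sl ∘ mat φ)
    Λ₀⇒stabilises-sl (φ∈Λ , traceless) =
      stabilises-cong (λ k → traceless⇒≈sl (traceless k)) (Λ⇒stabilises g-sym φ∈Λ)

    module Frame {m} (φs : Fin m → Quad n) (φs∈Λ₀ : ∀ r → InΛ₀ g (φs r))
                 {φ φ′} (φ∈Λ₀ : InΛ₀ g φ) (φ′∈Λ₀ : InΛ₀ g φ′) where

      A : Fin m → Fin n → M₂ F
      A r = mat (φs r)

      a b : Fin n → M₂ F
      a = mat φ
      b = mat φ′

      A-stab : ∀ r → Stabilises g (sl ∘ A r)
      A-stab r = Λ₀⇒stabilises-sl (φs∈Λ₀ r)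

      a-stab : Stabilises g (sl ∘ a)
      a-stab = Λ₀⇒stabilises-sl φ∈Λ₀

      b-stab : Stabilises g (sl ∘ b)
      b-stab = Λ₀⇒stabilises-sl φ′∈Λ₀

      gram : Fin n → F
      gram j = ψ (a j) (b j) * ψ (a j) (b j) - ψ (a j) (a j) * ψ (b j) (b j)

      gram-constant : ∀ j k → gram j ≈ gram k
      gram-constant j k = +-cong (*-cong ab ab) (-‿cong (*-cong aa bb))
        where
        ab : ψ (a j) (b j) ≈ ψ (a k) (b k)
        ab = ψ-constant {a} {b} a-stab b-stab j k
        aa : ψ (a j) (a j) ≈ ψ (a k) (a k)
        aa = ψ-constant {a} {a} a-stab a-stab j k
        bb : ψ (b j) (b j) ≈ ψ (b k) (b k)
        bb = ψ-constant {b} {b} b-stab b-stab j k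

      coefficients : Fin n → Fin m → Fin 3 → F
      coefficients k r = τ (A r k) (a k) (b k) ∷ ψ (A r k) (b k) ∷ ψ (A r k) (a k) ∷ []

      H B₁ B₂ : Fin n → M₂ F
      H j  = sl (a j) · sl (b j) ⊝ sl (b j) · sl (a j)
      B₁ j = ψ (a j) (b j) ∙ sl (a j) ⊝ ψ (a j) (a j) ∙ sl (b j)
      B₂ j = ψ (a j) (b j) ∙ sl (b j) ⊝ ψ (b j) (b j) ∙ sl (a j)

      β : (M₂ F → F) → Fin n → Fin 3 → F
      β π j = π (H j) ∷ π (B₁ j) ∷ π (B₂ j) ∷ []

      FrameComponent : (M₂ F → F) → Set ℓ
      FrameComponent π = ∀ j r → gram j * π (sl (A r j)) ≈
        (τ (A r j) (a j) (b j) * π (H j) + ψ (A r j) (b j) * π (B₁ j)) + ψ (A r j) (a j) * π (B₂ j)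

      frame-x : FrameComponent x
      frame-x j r = proj₁ (frame-expansion (A r j) (a j) (b j))

      frame-y : FrameComponent y
      frame-y j r = proj₁ (proj₂ (frame-expansion (A r j) (a j) (b j)))

      frame-z : FrameComponent z
      frame-z j r = proj₁ (proj₂ (proj₂ (frame-expansion (A r j) (a j) (b j))))

      frame-t : FrameComponent t
      frame-t j r = proj₂ (proj₂ (proj₂ (frame-expansion (A r j) (a j) (b j))))

      frame-constant : ∀ {π} → FrameComponent π → ∀ j k r →
        gram j * π (sl (A r j)) ≈ sum (λ i → coefficients k r i * β π j i)
      frame-constant {π} frameπ j k r = begin
        gram j * π (sl (A r j))
          ≈⟨ frameπ j r ⟩
        (τ (A r j) (a j) (b j) * π (H j) + ψ (A r j) (b j) * π (B₁ j)) + ψ (A r j) (a j) * π (B₂ j)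
          ≈⟨ +-cong (+-cong (*-congʳ (τ-constant {A r} {a} {b} (A-stab r) a-stab b-stab j k))
                            (*-congʳ (ψ-constant {A r} {b} (A-stab r) b-stab j k)))
                    (*-congʳ (ψ-constant {A r} {a} (A-stab r) a-stab j k)) ⟩
        (τ (A r k) (a k) (b k) * π (H j) + ψ (A r k) (b k) * π (B₁ j)) + ψ (A r k) (a k) * π (B₂ j)
          ≈⟨ trans (+-assoc _ _ _) (+-congˡ (+-congˡ (sym (+-identityʳ _)))) ⟩
        sum (λ i → coefficients k r i * β π j i) ∎

      vanishes : ∀ k (w : Fin m → F) → (∀ i → sum (λ r → w r * coefficients k r i) ≈ 0#) →
        ¬ (gram k ≈ 0#) → ∀ {π} → FrameComponent π →
        ∀ j → sum (λ r → w r * π (sl (A r j))) ≈ 0#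
      vanishes k w relation gram≉0 {π} frameπ j = *-cancelʳ-≈0 isField (begin
        sum (λ r → w r * π (sl (A r j))) * gram j
          ≈⟨ *-distribʳ-sum (gram j) (λ r → w r * π (sl (A r j))) ⟩
        sum (λ r → (w r * π (sl (A r j))) * gram j)
          ≈⟨ sum-cong-≋ (λ r → trans (*-assoc _ _ _)
               (*-congˡ (trans (*-comm _ _) (frame-constant {π} frameπ j k r)))) ⟩
        sum (λ r → w r * sum (λ i → coefficients k r i * β π j i))
          ≈⟨ ∑-annihilates w (coefficients k) (β π j) relation ⟩
        0# ∎) (λ gram≈0 → gram≉0 (trans (sym (gram-constant j k)) gram≈0))

      combination≈0 : ∀ k (w : Fin m → F) → (∀ i → sum (λ r → w r * coefficients k r i) ≈ 0#) →
        ¬ (gram k ≈ 0#) → IsZeroQuad (lincomb w φs)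
      combination≈0 k w relation gram≉0 j =
          trans (reflexive (sumᵈ≡sum (λ r → w r * X (φs r) j))) (vanishes′ {x} frame-x j)
        , trans (reflexive (sumᵈ≡sum (λ r → w r * Y (φs r) j))) (vanishes′ {y} frame-y j)
        , trans (reflexive (sumᵈ≡sum (λ r → w r * Z (φs r) j)))
            (trans (sum-cong-≋ (λ r → *-congˡ (inverseʳ-unique _ _ (proj₂ (φs∈Λ₀ r) j))))
                   (vanishes′ {z} frame-z j))
        , trans (reflexive (sumᵈ≡sum (λ r → w r * T (φs r) j))) (vanishes′ {t} frame-t j)
        where
        vanishes′ : ∀ {π} → FrameComponent π → ∀ j → sum (λ r → w r * π (sl (A r j))) ≈ 0#
        vanishes′ {π} = vanishes k w relation gram≉0 {π}

    gram≉0⇒dependent : ∀ {m} → 3 ℕ.< m → (φs : Fin m → Quad n) → (∀ r → InΛ₀ g (φs r)) →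
      ∀ {φ φ′} → InΛ₀ g φ → InΛ₀ g φ′ →
      ∀ k → ¬ (Ψ φ φ′ k * Ψ φ φ′ k - Ψ φ φ k * Ψ φ′ φ′ k ≈ 0#) → ¬ LinIndep φs
    gram≉0⇒dependent 3<m φs φs∈Λ₀ φ∈Λ₀ φ′∈Λ₀ k gram≉0 independent =
      let w , (r₀ , w≉0) , relation = nontrivialRelation isField _≈0? 3<m (coefficients k)
      in  w≉0 (independent w (combination≈0 k w relation gram≉0) r₀)
      where open Frame φs φs∈Λ₀ φ∈Λ₀ φ′∈Λ₀

    gram-degenerate : ∀ {m} → 3 ℕ.< m → (φs : Fin m → Quad n) → (∀ r → InΛ₀ g (φs r)) →
      LinIndep φs → ∀ {φ φ′} → InΛ₀ g φ → InΛ₀ g φ′ →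
      ∀ k → Ψ φ φ′ k * Ψ φ φ′ k ≈ Ψ φ φ k * Ψ φ′ φ′ k
    gram-degenerate 3<m φs φs∈Λ₀ independent {φ} {φ′} φ∈Λ₀ φ′∈Λ₀ k
      with (Ψ φ φ′ k * Ψ φ φ′ k - Ψ φ φ k * Ψ φ′ φ′ k) ≈0?
    ... | yes gram≈0 = x∙y⁻¹≈ε⇒x≈y _ _ gram≈0
    ... | no  gram≉0 =
      contradiction independent (gram≉0⇒dependent 3<m φs φs∈Λ₀ φ∈Λ₀ φ′∈Λ₀ k gram≉0)

    Ψ≈0-onΛ₀⁰ : ∀ {m} → 3 ℕ.< m → (φs : Fin m → Quad n) → (∀ r → InΛ₀ g (φs r)) →
      LinIndep φs → ∀ {φ φ′} → InΛ₀⁰ g φ → InΛ₀⁰ g φ′ → ∀ k → Ψ φ φ′ k ≈ 0#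
    Ψ≈0-onΛ₀⁰ 3<m φs φs∈Λ₀ independent {φ} {φ′}
              (φ∈Λ₀ , φ-nilpotent) (φ′∈Λ₀ , φ′-nilpotent) k with Ψ φ φ′ k ≈0?
    ... | yes Ψ≈0 = Ψ≈0
    ... | no  Ψ≉0 = *-cancelʳ-≈0 isField (begin
      Ψ φ φ′ k * Ψ φ φ′ k
        ≈⟨ gram-degenerate 3<m φs φs∈Λ₀ independent φ∈Λ₀ φ′∈Λ₀ k ⟩
      Ψ φ φ k * Ψ φ′ φ′ k
        ≈⟨ *-cong (Ψ-self≈0 {φ = φ} k (proj₂ φ∈Λ₀ k) (φ-nilpotent k))
                  (Ψ-self≈0 {φ = φ′} k (proj₂ φ′∈Λ₀ k) (φ′-nilpotent k)) ⟩
      0# * 0#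
        ≈⟨ zeroˡ 0# ⟩
      0# ∎) Ψ≉0

open import Data.Nat.Base using (_≤_; _*_; _+_)

-- Only four independent elements of Λ₀ are needed.
mainTheorem12 : ∀ {c ℓ : Level} (R : CommutativeRing c ℓ) → Over.IsField R
    → (q : ℕ) → Over.HasCard R q → (∃ λ t → q ≡ 2 * t + 1)
    → (n : ℕ) → 3 ≤ n
    → (g : Fin n → Fin n → CommutativeRing.Carrier R)
    → Over.IsLabeledGraph R g → Over.Connected R g
    → Over.DimΛ₀≥ R 5 g
    → ∀ φ φ' → Over.InΛ₀⁰ R g φ → Over.InΛ₀⁰ R g φ'
    → ∀ k → CommutativeRing._≈_ R (Over.Ψ R φ φ' k) (CommutativeRing.0# R)
mainTheorem12 R isField _ card _ _ _ g (g-sym , _) connected (φs , φs∈Λ₀ , independent)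
              φ φ' φ∈Λ₀⁰ φ'∈Λ₀⁰ =
  Ψ≈0-onΛ₀⁰ R isField (λ a → hasCard⇒≈? R card a (CommutativeRing.0# R)) g-sym connected
    (ℕ.n≤1+n 4) φs φs∈Λ₀ independent φ∈Λ₀⁰ φ'∈Λ₀⁰
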